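{- Let $p$ be an odd prime, $q$ a power of $p$, $l\ge 0$ an integer, and $k=2$. Then $D_{p^l+1,k}(1,x)$ is a permutation polynomial of $\mathbb{F}_q$ if and only if $\gcd\big(\frac{p^l-1}{2},\,q-1\big)=1$.
   Context: For an integer $k$ with $0\le k\le p-1$ and an integer $n\ge1$, $D_{n,k}(1,x)=\sum_{i=0}^{\lfloor n/2\rfloor}\frac{n-ki}{n-i}\binom{n-i}{i}(-x)^i\in\mathbb{F}_q[x]$ (the coefficients are integers, reduced mod $p$). A permutation polynomial of $\mathbb{F}_q$ is a polynomial inducing a bijection of $\mathbb{F}_q$. -}

module Defs where

open import Level using (Level; _⊔_)
open import Data.Nat as ℕ using (ℕ; zero; suc; _∸_; _≤_; _<_)
open import Data.Nat.Combinatorics using (_C_)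
open import Data.Nat.Primality using (Prime)
open import Data.Fin using (Fin)
open import Data.Integer as ℤ using (ℤ; +_; -[1+_])
open import Data.Integer.DivMod using (_/ℕ_)
open import Data.Product using (Σ)
open import Relation.Nullary using (¬_)
open import Relation.Binary.PropositionalEquality using (_≡_)
open import Function.Definitions using (Bijective)
open import Algebra.Bundles using (CommutativeRing; Semiring)
import Algebra.Definitions.RawSemiring as RS

-- Exact integer division by a natural number (used only with a nonzero
-- divisor; the zero case is a dummy value).
_divBy_ : ℤ → ℕ → ℤ
a divBy zero    = + 0
a divBy (suc m) = a /ℕ suc m

-- The integer coefficient  (n - k i)/(n - i) * binom(n - i, i)
-- (an integer for 0 ≤ i ≤ ⌊n/2⌋, n ≥ 1; computed by exact division).
dicksonCoeff : ℕ → ℕ → ℕ → ℤ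
dicksonCoeff n k i =
  ((+ n ℤ.- + (k ℕ.* i)) ℤ.* + ((n ∸ i) C i)) divBy (n ∸ i)

record FiniteField (c ℓ : Level) (q : ℕ) : Set (Level.suc (c ⊔ ℓ)) where
  field
    commRing : CommutativeRing c ℓ
  open CommutativeRing commRing public
  field
    1≉0      : ¬ (1# ≈ 0#)
    inverse  : ∀ x → ¬ (x ≈ 0#) → Σ Carrier (λ y → (x * y) ≈ 1#)
    enum     : Fin q → Carrier
    enum-bij : Bijective _≡_ _≈_ enum

module _ {c ℓ : Level} {q : ℕ} (F : FiniteField c ℓ q) where
  open FiniteField F
  open RS (Semiring.rawSemiring semiring) using (_^_) renaming (_×_ to _·_)

  fromℤ : ℤ → Carrier
  fromℤ (+ n)      = n · 1#
  fromℤ -[1+ n ]   = - (suc n · 1#)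

  HasChar : ℕ → Set ℓ
  HasChar p = (p · 1#) ≈ 0#

  sumTo : ℕ → (ℕ → Carrier) → Carrier
  sumTo zero    f = f 0
  sumTo (suc m) f = sumTo m f + f (suc m)

  D : ℕ → ℕ → Carrier → Carrier
  D n k x = sumTo (n ℕ./ 2) (λ i → fromℤ (dicksonCoeff n k i) * ((- x) ^ i))

  IsPermutation : (Carrier → Carrier) → Set (c ⊔ ℓ)
  IsPermutation f = Bijective _≈_ _≈_ f

{-# OPTIONS --safe #-}
module Submission where

-- For k = 2, D_{n+1,2}(1,x) is the reversed Dickson polynomial of the second kind
-- E_n(x) = Σ_i C(n-i,i) (-x)^i, which satisfies E_{n+2} = E_{n+1} - x E_n.  Adjoining
-- s = √t with t = 1 - 4x, this recurrence gives Binet's formula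
--   2^(n+1) s E_n(x) = (1 + s)^(n+1) - (1 - s)^(n+1).
-- For n = p^l = 2d + 1 the Frobenius map turns the right-hand side into 2s(1 + t^d) and
-- 2^(n+1) into 4, so that 2 D_{p^l+1,2}(1,x) = 1 + (1 - 4x)^d.  Since x ↦ 1 - 4x is a
-- bijection, D permutes F_q exactly when y ↦ y^d does.  If g = gcd(d, q - 1) is 1, Fermat's
-- little theorem yields an inverse power map; if g > 1 and y ↦ y^d were injective, every
-- unit would be a root of y^((q-1)/g) - 1, too many roots for its degree.

open import Level using (Level; _⊔_)
open import Data.Nat.Base as ℕ using (ℕ; zero; suc)
import Data.Nat.Properties as ℕ
open import Data.Nat.Primality using (Prime; prime⇒nonTrivial; prime⇒nonZero)
open import Data.Integer.Base using (+_)
open import Data.Product.Base using (Σ; _,_; proj₁; proj₂)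
open import Relation.Nullary using (¬_; yes; no; contradiction)
open import Relation.Binary.PropositionalEquality as ≡ using (_≡_)
open import Algebra.Bundles using (CommutativeRing; Semiring; AbelianGroup)
import Algebra.Definitions.RawSemiring as RawSemiring
open import Defs

module BinomialCoefficients where

  open import Data.Nat.Base
  open import Data.Nat.Properties
  open import Data.Nat.Combinatorics
  open import Data.Nat.Divisibility using (_∣_; divides; ∣⇒≤)
  open import Data.Nat.DivMod using (m*n/n≡m)
  open import Data.Nat.Primality using (euclidsLemma)
  open import Data.Nat.Tactic.RingSolver using (solve-∀)
  import Data.Integer.Base as ℤ
  import Data.Integer.Properties as ℤ
  open import Data.Empty using (⊥-elim)
  open import Data.Sum.Base using (inj₁; inj₂)
  open import Relation.Binary.PropositionalEquality
  open ≡-Reasoning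

  [1+k]*[1+n]C[1+k]≡[1+n]*nCk : ∀ n k → suc k * (suc n C suc k) ≡ suc n * (n C k)
  [1+k]*[1+n]C[1+k]≡[1+n]*nCk zero zero = refl
  [1+k]*[1+n]C[1+k]≡[1+n]*nCk zero (suc k) = begin
    suc (suc k) * (1 C suc (suc k)) ≡⟨ cong (suc (suc k) *_) (k>n⇒nCk≡0 {1} {2 + k} (s<s z<s)) ⟩
    suc (suc k) * 0                 ≡⟨ *-zeroʳ (suc (suc k)) ⟩
    0                               ≡⟨ cong (1 *_) (k>n⇒nCk≡0 {0} {suc k} z<s) ⟨
    1 * (0 C suc k)                 ∎
  [1+k]*[1+n]C[1+k]≡[1+n]*nCk (suc n) zero = trans (+-identityʳ _) (trans (nC1≡n (2 + n)) (sym (*-identityʳ _)))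
  [1+k]*[1+n]C[1+k]≡[1+n]*nCk (suc n) (suc k) = begin
    (2 + k) * ((2 + n) C (2 + k))         ≡⟨ cong ((2 + k) *_) (nCk+nC[k+1]≡[n+1]C[k+1] (suc n) (suc k)) ⟨
    (2 + k) * (A + B)                      ≡⟨ distrib (suc k) A B ⟩
    (suc k * A + A) + (2 + k) * B
      ≡⟨ cong₂ (λ u v → (u + A) + v) ([1+k]*[1+n]C[1+k]≡[1+n]*nCk n k) ([1+k]*[1+n]C[1+k]≡[1+n]*nCk n (suc k)) ⟩
    (suc n * (n C k) + A) + suc n * (n C suc k) ≡⟨ regroup (suc n) (n C k) A (n C suc k) ⟩
    suc n * ((n C k) + (n C suc k)) + A   ≡⟨ cong (λ u → suc n * u + A) (nCk+nC[k+1]≡[n+1]C[k+1] n k) ⟩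
    suc n * A + A                          ≡⟨ +-comm (suc n * A) A ⟩
    (2 + n) * A                            ∎
    where
    A B : ℕ
    A = suc n C suc k
    B = suc n C (2 + k)
    distrib : ∀ a b c → suc a * (b + c) ≡ (a * b + b) + suc a * c
    distrib = solve-∀
    regroup : ∀ a b c e → (a * b + c) + a * e ≡ a * (b + e) + c
    regroup = solve-∀

  p∣pCk : ∀ {p k} → Prime p → 0 < k → k < p → p ∣ p C k
  p∣pCk {suc p} {suc k} p-prime _ k<p with euclidsLemma (suc k) (suc p C suc k) p-prime
    (divides (p C k) (trans ([1+k]*[1+n]C[1+k]≡[1+n]*nCk p k) (*-comm (suc p) _)))
  ... | inj₁ p∣k   = ⊥-elim (<⇒≱ k<p (∣⇒≤ p∣k))
  ... | inj₂ p∣pCk = p∣pCk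

  [1+n∸k]*[1+n]Ck≡[1+n]*nCk : ∀ n k → (suc n ∸ k) * (suc n C k) ≡ suc n * (n C k)
  [1+n∸k]*[1+n]Ck≡[1+n]*nCk n k with ≤-<-connex k n
  ... | inj₁ k≤n = begin
    (suc n ∸ k) * (suc n C k)
      ≡⟨ cong₂ _*_ n+1∸k (trans (nCk≡nC[n∸k] (m≤n⇒m≤1+n k≤n)) (cong (suc n C_) n+1∸k)) ⟩
    suc (n ∸ k) * (suc n C suc (n ∸ k))         ≡⟨ [1+k]*[1+n]C[1+k]≡[1+n]*nCk n (n ∸ k) ⟩
    suc n * (n C (n ∸ k))                       ≡⟨ cong (suc n *_) (nCk≡nC[n∸k] k≤n) ⟨
    suc n * (n C k)                             ∎
    where
    n+1∸k : suc n ∸ k ≡ suc (n ∸ k)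
    n+1∸k = +-∸-assoc 1 k≤n
  ... | inj₂ n<k = begin
    (suc n ∸ k) * (suc n C k)  ≡⟨ cong (_* (suc n C k)) (m≤n⇒m∸n≡0 n<k) ⟩
    0                          ≡⟨ *-zeroʳ (suc n) ⟨
    suc n * 0                  ≡⟨ cong (suc n *_) (k>n⇒nCk≡0 n<k) ⟨
    suc n * (n C k)            ∎

  [1+n∸k]C[1+k]≡[n∸k]Ck+[n∸k]C[1+k] : ∀ n k → (suc n ∸ k) C suc k ≡ (n ∸ k) C k + (n ∸ k) C suc k
  [1+n∸k]C[1+k]≡[n∸k]Ck+[n∸k]C[1+k] n k with ≤-<-connex k n
  ... | inj₁ k≤n = trans (cong (_C suc k) (+-∸-assoc 1 k≤n)) (sym (nCk+nC[k+1]≡[n+1]C[k+1] (n ∸ k) k))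
  ... | inj₂ n<k = begin
    (suc n ∸ k) C suc k            ≡⟨ cong (_C suc k) (m≤n⇒m∸n≡0 n<k) ⟩
    0                              ≡⟨ cong₂ _+_ (k>n⇒nCk≡0 0<k) (k>n⇒nCk≡0 (m<n⇒m<1+n 0<k)) ⟨
    0 C k + 0 C suc k              ≡⟨ cong (λ a → a C k + a C suc k) (m≤n⇒m∸n≡0 (<⇒≤ n<k)) ⟨
    (n ∸ k) C k + (n ∸ k) C suc k  ∎
    where
    0<k : 0 < k
    0<k = ≤-<-trans z≤n n<k

  dicksonCoeff[1+m,2,i]≡[m∸i]Ci : ∀ m i → i + i ≤ suc m → dicksonCoeff (suc m) 2 i ≡ + ((m ∸ i) C i)
  dicksonCoeff[1+m,2,i]≡[m∸i]Ci m i 2i≤1+m = begin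
    ((+ suc m ℤ.- + (2 * i)) ℤ.* + ((suc m ∸ i) C i)) divBy (suc m ∸ i)
      ≡⟨ cong₂ (λ a b → ((+ suc m ℤ.- + (2 * i)) ℤ.* + (a C i)) divBy b) 1+m∸i 1+m∸i ⟩
    ((+ suc m ℤ.- + (2 * i)) ℤ.* + (suc M C i)) divBy suc M
      ≡⟨ cong (λ a → (a ℤ.* + (suc M C i)) divBy suc M) numerator ⟩
    (+ (suc M ∸ i) ℤ.* + (suc M C i)) divBy suc M
      ≡⟨ cong (_divBy suc M) (ℤ.pos-* (suc M ∸ i) (suc M C i)) ⟨
    (+ ((suc M ∸ i) * (suc M C i))) divBy suc M
      ≡⟨ cong (λ a → (+ a) divBy suc M) (trans ([1+n∸k]*[1+n]Ck≡[1+n]*nCk M i) (*-comm (suc M) (M C i))) ⟩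
    (+ ((M C i) * suc M)) divBy suc M
      ≡⟨ cong +_ (m*n/n≡m (M C i) (suc M)) ⟩
    + (M C i) ∎
    where
    M : ℕ
    M = m ∸ i
    i≤m : i ≤ m
    i≤m = half≤ i 2i≤1+m
      where
      half≤ : ∀ j → j + j ≤ suc m → j ≤ m
      half≤ zero    _       = z≤n
      half≤ (suc j) (s≤s h) = ≤-trans (m≤n+m (suc j) j) h
    1+m∸i : suc m ∸ i ≡ suc M
    1+m∸i = +-∸-assoc 1 i≤m
    numerator : + suc m ℤ.- + (2 * i) ≡ + (suc M ∸ i)
    numerator = begin
      + suc m ℤ.- + (2 * i)  ≡⟨ ℤ.m-n≡m⊖n (suc m) (2 * i) ⟩
      suc m ℤ.⊖ (2 * i)      ≡⟨ ℤ.⊖-≥ (subst (_≤ suc m) (sym 2*i≡i+i) 2i≤1+m) ⟩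
      + (suc m ∸ 2 * i)      ≡⟨ cong (λ a → + (suc m ∸ a)) 2*i≡i+i ⟩
      + (suc m ∸ (i + i))    ≡⟨ cong +_ (∸-+-assoc (suc m) i i) ⟨
      + (suc m ∸ i ∸ i)      ≡⟨ cong (λ a → + (a ∸ i)) 1+m∸i ⟩
      + (suc M ∸ i)          ∎
      where
      2*i≡i+i : 2 * i ≡ i + i
      2*i≡i+i = cong (λ a → i + a) (+-identityʳ i)

module Arithmetic where

  open import Data.Nat.Base
  open import Data.Nat.Properties
  open import Data.Nat.DivMod using (m≡m%n+[m/n]*n; m*n/n≡m; %-distribˡ-*)
  open import Data.Nat.GCD using (gcd; GCD; gcd-GCD; module Bézout)
  open import Data.Nat.Tactic.RingSolver using (solve-∀)
  open import Data.Product.Base using (∃₂)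
  open import Data.Empty using (⊥-elim)
  open import Relation.Binary.PropositionalEquality
  open ≡-Reasoning

  odd-^ : ∀ m n → m % 2 ≡ 1 → m ^ n % 2 ≡ 1
  odd-^ m zero    _     = refl
  odd-^ m (suc n) m-odd = trans (%-distribˡ-* m (m ^ n) 2) (cong₂ (λ a b → a * b % 2) m-odd (odd-^ m n m-odd))

  odd⇒n≡[n∸1]/2+[1+[n∸1]/2] : ∀ n → n % 2 ≡ 1 → n ≡ (n ∸ 1) / 2 + suc ((n ∸ 1) / 2)
  odd⇒n≡[n∸1]/2+[1+[n∸1]/2] n n-odd = begin
    n                                  ≡⟨ n≡1+h*2 ⟩
    1 + n / 2 * 2                      ≡⟨ 1+h*2≡h+[1+h] (n / 2) ⟩
    n / 2 + suc (n / 2)                ≡⟨ cong (λ h → h + suc h) h≡[n∸1]/2 ⟩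
    (n ∸ 1) / 2 + suc ((n ∸ 1) / 2)    ∎
    where
    n≡1+h*2 : n ≡ 1 + n / 2 * 2
    n≡1+h*2 = trans (m≡m%n+[m/n]*n n 2) (cong (_+ n / 2 * 2) n-odd)
    h≡[n∸1]/2 : n / 2 ≡ (n ∸ 1) / 2
    h≡[n∸1]/2 = trans (sym (m*n/n≡m (n / 2) 2)) (cong (λ a → (a ∸ 1) / 2) (sym n≡1+h*2))
    1+h*2≡h+[1+h] : ∀ h → 1 + h * 2 ≡ h + suc h
    1+h*2≡h+[1+h] = solve-∀

  odd-prime≥3 : ∀ {p} → Prime p → p % 2 ≡ 1 → 3 ≤ p
  odd-prime≥3 {0}                 p-prime _  = ⊥-elim (NonTrivial.nonTrivial (prime⇒nonTrivial p-prime))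
  odd-prime≥3 {1}                 p-prime _  = ⊥-elim (NonTrivial.nonTrivial (prime⇒nonTrivial p-prime))
  odd-prime≥3 {2}                 _       ()
  odd-prime≥3 {suc (suc (suc _))} _       _  = s≤s (s≤s (s≤s z≤n))

  odd-prime-power≥3 : ∀ {p m} → Prime p → p % 2 ≡ 1 → 1 ≤ m → 3 ≤ p ^ m
  odd-prime-power≥3 {p} {m} p-prime p-odd 1≤m =
    ≤-trans (odd-prime≥3 p-prime p-odd) (subst (_≤ p ^ m) (*-identityʳ p) (^-monoʳ-≤ p {{prime⇒nonZero p-prime}} 1≤m))

  coprime⇒∃inverse : ∀ e m .{{_ : NonTrivial m}} → gcd e m ≡ 1 → ∃₂ λ a k → e * a ≡ 1 + k * m
  coprime⇒∃inverse e (suc (suc n)) gcd≡1 with Bézout.identity (subst (GCD e (2 + n)) gcd≡1 (gcd-GCD e (2 + n)))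
  ... | Bézout.+- x y eq       = x , y , trans (*-comm e x) (sym eq)
  ... | Bézout.-+ x zero eq    = ⊥-elim (1+n≢0 eq)
  -- Here x * e ≡ -1 and 1 + n ≡ -1 modulo 2 + n, so x * (1 + n) inverts e.
  ... | Bézout.-+ x (suc y) eq = x * suc n , n + suc n * y , +-cancelʳ-≡ (suc n) _ _ (begin
    e * (x * suc n) + suc n                ≡⟨ expand e x n ⟩
    suc n * (1 + x * e)                    ≡⟨ cong (suc n *_) eq ⟩
    suc n * (suc y * (2 + n))              ≡⟨ regroup y n ⟩
    1 + (n + suc n * y) * (2 + n) + suc n  ∎)
    where
    expand : ∀ e x n → e * (x * suc n) + suc n ≡ suc n * (1 + x * e)
    expand = solve-∀
    regroup : ∀ y n → suc n * (suc y * (2 + n)) ≡ 1 + (n + suc n * y) * (2 + n) + suc n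
    regroup = solve-∀

module RingSolver {c ℓ} (R : CommutativeRing c ℓ) where

  open import Data.Integer.Base as ℤ using (ℤ; -[1+_]; _⊖_; _◃_)
  import Data.Integer.Properties as ℤ
  open import Data.Sign.Base as Sign using (Sign)
  open import Data.Maybe.Base using (Maybe; just; nothing)
  open import Algebra.Solver.Ring.AlmostCommutativeRing using (_-Raw-AlmostCommutative⟶_; fromCommutativeRing)
  open CommutativeRing R
  open import Algebra.Properties.Ring ring
  open import Algebra.Properties.Semiring.Mult.TCOptimised semiring
  open import Relation.Binary.Reasoning.Setoid setoid

  -- The type-checking-optimised _×_ makes cast (+ 1) and cast (+ 2) reduce to 1# and
  -- 1# + 1#, the forms in which these constants occur in goals.
  cast : ℤ → Carrier
  cast (+ n)    = n × 1#
  cast -[1+ n ] = - (suc n × 1#)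

  private
    signed : Sign → Carrier → Carrier
    signed Sign.+ a = a
    signed Sign.- a = - a

    signed-cong : ∀ s {a b} → a ≈ b → signed s a ≈ signed s b
    signed-cong Sign.+ a≈b = a≈b
    signed-cong Sign.- a≈b = -‿cong a≈b

    signed-* : ∀ s t a b → signed (s Sign.* t) (a * b) ≈ signed s a * signed t b
    signed-* Sign.+ Sign.+ a b = refl
    signed-* Sign.+ Sign.- a b = -‿distribʳ-* a b
    signed-* Sign.- Sign.+ a b = -‿distribˡ-* a b
    signed-* Sign.- Sign.- a b = begin
      a * b            ≈⟨ -‿involutive (a * b) ⟨
      - - (a * b)      ≈⟨ -‿cong (-‿distribʳ-* a b) ⟩
      - (a * - b)      ≈⟨ -‿distribˡ-* a (- b) ⟩
      - a * - b        ∎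

    cast-◃ : ∀ s n → cast (s ◃ n) ≈ signed s (n × 1#)
    cast-◃ Sign.+ zero    = refl
    cast-◃ Sign.- zero    = sym -0#≈0#
    cast-◃ Sign.+ (suc n) = refl
    cast-◃ Sign.- (suc n) = refl

    cast≈signed∣∣ : ∀ i → cast i ≈ signed (ℤ.sign i) (ℤ.∣ i ∣ × 1#)
    cast≈signed∣∣ i = trans (reflexive (≡.cong cast (≡.sym (ℤ.◃-inverse i)))) (cast-◃ (ℤ.sign i) ℤ.∣ i ∣)

    cast-⊖ : ∀ m n → cast (m ⊖ n) ≈ m × 1# - n × 1#
    cast-⊖ m       zero    = sym (trans (+-congˡ -0#≈0#) (+-identityʳ _))
    cast-⊖ zero    (suc n) = sym (+-identityˡ _)
    cast-⊖ (suc m) (suc n) = begin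
      cast (suc m ⊖ suc n)        ≡⟨ ≡.cong cast (ℤ.[1+m]⊖[1+n]≡m⊖n m n) ⟩
      cast (m ⊖ n)                ≈⟨ cast-⊖ m n ⟩
      m × 1# - n × 1#              ≈⟨ cancel-1 (m × 1#) (n × 1#) ⟨
      (1# + m × 1#) - (1# + n × 1#) ≈⟨ +-cong (×-homo-+ 1# 1 m) (-‿cong (×-homo-+ 1# 1 n)) ⟨
      suc m × 1# - suc n × 1#      ∎
      where
      cancel-1 : ∀ a b → (1# + a) - (1# + b) ≈ a - b
      cancel-1 a b = begin
        (1# + a) + - (1# + b)   ≈⟨ +-congˡ (-‿+-comm 1# b) ⟨
        (1# + a) + (- 1# + - b) ≈⟨ +-assoc 1# a _ ⟩
        1# + (a + (- 1# + - b)) ≈⟨ +-congˡ (trans (sym (+-assoc a _ _)) (trans (+-congʳ (+-comm a _)) (+-assoc _ a _))) ⟩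
        1# + (- 1# + (a - b))   ≈⟨ +-assoc 1# _ _ ⟨
        (1# - 1#) + (a - b)     ≈⟨ +-congʳ (-‿inverseʳ 1#) ⟩
        0# + (a - b)            ≈⟨ +-identityˡ _ ⟩
        a - b                   ∎

  cast-+ : ∀ i j → cast (i ℤ.+ j) ≈ cast i + cast j
  cast-+ (+ m)    (+ n)    = ×-homo-+ 1# m n
  cast-+ (+ m)    -[1+ n ] = cast-⊖ m (suc n)
  cast-+ -[1+ m ] (+ n)    = trans (cast-⊖ n (suc m)) (+-comm _ _)
  cast-+ -[1+ m ] -[1+ n ] = begin
    - (suc (suc (m ℕ.+ n)) × 1#)        ≈⟨ -‿cong (reflexive (≡.cong (_× 1#) (≡.sym (ℕ.+-suc (suc m) n)))) ⟩
    - ((suc m ℕ.+ suc n) × 1#)          ≈⟨ -‿cong (×-homo-+ 1# (suc m) (suc n)) ⟩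
    - (suc m × 1# + suc n × 1#)         ≈⟨ -‿+-comm _ _ ⟨
    - (suc m × 1#) + - (suc n × 1#)     ∎

  cast-* : ∀ i j → cast (i ℤ.* j) ≈ cast i * cast j
  cast-* i j = begin
    cast (i ℤ.* j)                                   ≈⟨ cast-◃ (s Sign.* t) (ℤ.∣ i ∣ ℕ.* ℤ.∣ j ∣) ⟩
    signed (s Sign.* t) ((ℤ.∣ i ∣ ℕ.* ℤ.∣ j ∣) × 1#)  ≈⟨ signed-cong (s Sign.* t) (×1-homo-* ℤ.∣ i ∣ ℤ.∣ j ∣) ⟩
    signed (s Sign.* t) ((ℤ.∣ i ∣ × 1#) * (ℤ.∣ j ∣ × 1#)) ≈⟨ signed-* s t _ _ ⟩
    signed s (ℤ.∣ i ∣ × 1#) * signed t (ℤ.∣ j ∣ × 1#) ≈⟨ *-cong (cast≈signed∣∣ i) (cast≈signed∣∣ j) ⟨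
    cast i * cast j                                 ∎
    where
    s t : Sign
    s = ℤ.sign i
    t = ℤ.sign j

  cast-neg : ∀ i → cast (ℤ.- i) ≈ - cast i
  cast-neg -[1+ n ]  = sym (-‿involutive _)
  cast-neg (+ zero)  = sym -0#≈0#
  cast-neg (+ suc n) = refl

  ℤ⟶R : CommutativeRing.rawRing ℤ.+-*-commutativeRing -Raw-AlmostCommutative⟶ fromCommutativeRing R
  ℤ⟶R = record
    { ⟦_⟧    = cast
    ; +-homo = cast-+
    ; *-homo = cast-*
    ; -‿homo = cast-neg
    ; 0-homo = refl
    ; 1-homo = refl
    }

  private
    coeff≟ : ∀ i j → Maybe (cast i ≈ cast j)
    coeff≟ i j with i ℤ.≟ j
    ... | yes ≡.refl = just refl
    ... | no _       = nothing

  open import Algebra.Solver.Ring _ _ ℤ⟶R coeff≟ public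

module CommutativeRingProperties {c ℓ} (R : CommutativeRing c ℓ) where

  open import Data.Product.Base using (_×_)
  open CommutativeRing R
  open RawSemiring (Semiring.rawSemiring semiring) using (_^_) renaming (_×_ to _·_)
  open import Relation.Binary.Reasoning.Setoid setoid
  open RingSolver R using (solve; _:=_; _:+_; _:*_; _:-_; :-_; con; Polynomial)

  private
    𝟙 𝟚 : ∀ {n} → Polynomial n
    𝟙 = con (+ 1)
    𝟚 = 𝟙 :+ 𝟙

  1^n≈1 : ∀ n → 1# ^ n ≈ 1#
  1^n≈1 zero    = refl
  1^n≈1 (suc n) = trans (*-identityˡ _) (1^n≈1 n)

  Recurrence : Carrier → Carrier → (ℕ → Carrier) → Set ℓ
  Recurrence α β u = ∀ n → u (suc (suc n)) ≈ α * u (suc n) + β * u n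

  recurrence-unique : ∀ {α β u v} → Recurrence α β u → Recurrence α β v →
                      u 0 ≈ v 0 → u 1 ≈ v 1 → ∀ n → u n ≈ v n
  recurrence-unique {α} {β} {u} {v} rec-u rec-v u0≈v0 u1≈v1 n = proj₁ (consecutive n)
    where
    consecutive : ∀ n → u n ≈ v n × u (suc n) ≈ v (suc n)
    consecutive zero    = u0≈v0 , u1≈v1
    consecutive (suc n) = let (uₙ≈vₙ , uₙ₊₁≈vₙ₊₁) = consecutive n in
      uₙ₊₁≈vₙ₊₁ , trans (rec-u n) (trans (+-cong (*-congˡ uₙ₊₁≈vₙ₊₁) (*-congˡ uₙ≈vₙ)) (sym (rec-v n)))

  recurrence-suc : ∀ {α β u} → Recurrence α β u → Recurrence α β (λ n → u (suc n))
  recurrence-suc rec n = rec (suc n)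

  recurrence-- : ∀ {α β u v} → Recurrence α β u → Recurrence α β v → Recurrence α β (λ n → u n - v n)
  recurrence-- {α} {β} {u} {v} rec-u rec-v n = trans (+-cong (rec-u n) (-‿cong (rec-v n)))
    (solve 6 (λ α β a b c d → (α :* a :+ β :* b) :- (α :* c :+ β :* d) := α :* (a :- c) :+ β :* (b :- d))
      refl α β (u (suc n)) (u n) (v (suc n)) (v n))

  recurrence-^ : ∀ {α β z} → z * z ≈ α * z + β → Recurrence α β (z ^_)
  recurrence-^ {α} {β} {z} z²≈αz+β n = begin
    z * (z * z ^ n)        ≈⟨ *-assoc z z _ ⟨
    (z * z) * z ^ n        ≈⟨ *-congʳ z²≈αz+β ⟩
    (α * z + β) * z ^ n    ≈⟨ solve 4 (λ α β z y → (α :* z :+ β) :* y := α :* (z :* y) :+ β :* y) refl α β z (z ^ n) ⟩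
    α * (z * z ^ n) + β * z ^ n ∎

  two four : Carrier
  two  = 1# + 1#
  four = two * two

  module _ {s c : Carrier} (s²≈1-4c : s * s ≈ 1# - four * c) where

    private
      square : ∀ σ → σ * σ ≈ s * s → (1# + σ) * (1# + σ) ≈ two * (1# + σ) + - (four * c)
      square σ σ²≈s² = begin
        (1# + σ) * (1# + σ)          ≈⟨ solve 1 (λ σ → (𝟙 :+ σ) :* (𝟙 :+ σ) := 𝟙 :+ 𝟚 :* σ :+ σ :* σ) refl σ ⟩
        1# + two * σ + σ * σ          ≈⟨ +-congˡ (trans σ²≈s² s²≈1-4c) ⟩
        1# + two * σ + (1# - four * c)
          ≈⟨ solve 2 (λ σ c → 𝟙 :+ 𝟚 :* σ :+ (𝟙 :- 𝟚 :* 𝟚 :* c) := 𝟚 :* (𝟙 :+ σ) :+ :- (𝟚 :* 𝟚 :* c)) refl σ c ⟩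
        two * (1# + σ) + - (four * c) ∎

    binet : ∀ {e : ℕ → Carrier} → e 0 ≈ 1# → e 1 ≈ 1# → (∀ n → e (suc (suc n)) ≈ e (suc n) - c * e n) →
            ∀ n → two ^ suc n * (s * e n) ≈ (1# + s) ^ suc n - (1# - s) ^ suc n
    binet {e} e0≈1 e1≈1 rec-e = recurrence-unique rec-u rec-v base₀ base₁
      where
      rec-u : Recurrence two (- (four * c)) (λ n → two ^ suc n * (s * e n))
      rec-u n = trans (*-congˡ (*-congˡ (rec-e n)))
        (solve 5 (λ P s c a b → 𝟚 :* (𝟚 :* P) :* (s :* (a :- c :* b))
                              := 𝟚 :* (𝟚 :* P :* (s :* a)) :+ :- (𝟚 :* 𝟚 :* c) :* (P :* (s :* b)))
          refl (two ^ suc n) s c (e (suc n)) (e n))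
      rec-v : Recurrence two (- (four * c)) (λ n → (1# + s) ^ suc n - (1# - s) ^ suc n)
      rec-v = recurrence-- (recurrence-suc (recurrence-^ (square s refl)))
                           (recurrence-suc (recurrence-^ (square (- s) (solve 1 (λ s → :- s :* :- s := s :* s) refl s))))
      base₀ : two * 1# * (s * e 0) ≈ (1# + s) * 1# - (1# - s) * 1#
      base₀ = trans (*-congˡ (*-congˡ e0≈1))
        (solve 1 (λ s → 𝟚 :* 𝟙 :* (s :* 𝟙) := (𝟙 :+ s) :* 𝟙 :- (𝟙 :- s) :* 𝟙) refl s)
      base₁ : two * (two * 1#) * (s * e 1) ≈ (1# + s) * ((1# + s) * 1#) - (1# - s) * ((1# - s) * 1#)
      base₁ = trans (*-congˡ (*-congˡ e1≈1))
        (solve 1 (λ s → 𝟚 :* (𝟚 :* 𝟙) :* (s :* 𝟙)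
                     := (𝟙 :+ s) :* ((𝟙 :+ s) :* 𝟙) :- (𝟙 :- s) :* ((𝟙 :- s) :* 𝟙)) refl s)


  module Frobenius {p : ℕ} (p-prime : Prime p) (char-p : p · 1# ≈ 0#) where

    open import Data.Nat.Combinatorics using (_C_; nCn≡1)
    open import Data.Nat.Divisibility using (divides)
    open import Data.Fin.Base as Fin using (Fin; toℕ; inject₁)
    import Data.Fin.Properties as Fin
    open import Data.Vec.Functional using (init; last)
    open import Algebra.Properties.Group +-group using (inverseʳ-unique)
    open import Algebra.Properties.Semiring.Mult semiring
    open import Algebra.Properties.Semiring.Exp semiring using (^-congˡ; ^-assocʳ; ^-homo-*)
    open import Algebra.Properties.CommutativeSemiring.Exp commutativeSemiring using (^-distrib-*)
    open import Algebra.Properties.Monoid.Sum +-monoid using (sum; sum-init-last; sum-cong-≋; sum-replicate-zero)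
    import Algebra.Properties.CommutativeSemiring.Binomial commutativeSemiring as Binomial
    open BinomialCoefficients using (p∣pCk)

    private
      p*j·x≈0 : ∀ j x → (p ℕ.* j) · x ≈ 0#
      p*j·x≈0 j x = begin
        (p ℕ.* j) · x                 ≈⟨ ×-congʳ (p ℕ.* j) (*-identityˡ x) ⟨
        (p ℕ.* j) · (1# * x)          ≈⟨ ×-assoc-* (p ℕ.* j) 1# x ⟨
        ((p ℕ.* j) · 1#) * x          ≈⟨ *-congʳ (×1-homo-* p j) ⟩
        ((p · 1#) * (j · 1#)) * x     ≈⟨ *-congʳ (trans (*-congʳ char-p) (zeroˡ _)) ⟩
        0# * x                        ≈⟨ zeroˡ x ⟩
        0#                            ∎

    frobenius : ∀ a b → (a + b) ^ p ≈ a ^ p + b ^ p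
    frobenius a b = expand p ≡.refl (prime⇒nonTrivial p-prime)
      where
      expand : ∀ n → n ≡ p → ℕ.NonTrivial n → (a + b) ^ n ≈ a ^ n + b ^ n
      expand (suc (suc m)) ≡.refl _ = begin
        (a + b) ^ p                                   ≈⟨ Binomial.theorem p a b ⟩
        term Fin.zero + sum inner                     ≈⟨ +-congˡ (sum-init-last inner) ⟩
        term Fin.zero + (sum (init inner) + last inner)
          ≈⟨ +-cong first (+-cong (trans (sum-cong-≋ middle) (sum-replicate-zero (suc m))) final) ⟩
        b ^ p + (0# + a ^ p)                          ≈⟨ trans (+-congˡ (+-identityˡ _)) (+-comm _ _) ⟩
        a ^ p + b ^ p                                 ∎
        where
        term : Fin (suc p) → Carrier
        term = Binomial.binomialTerm a b p
        inner : Fin (suc (suc m)) → Carrier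
        inner i = term (Fin.suc i)
        first : term Fin.zero ≈ b ^ p
        first = trans (×-homo-1 _) (*-identityˡ _)
        final : last inner ≈ a ^ p
        final = begin
          last inner
            ≡⟨ ≡.cong (λ k → (p C k) · (a ^ k * b ^ (p ℕ.∸ k))) (≡.cong suc (Fin.toℕ-fromℕ (suc m))) ⟩
          (p C p) · (a ^ p * b ^ (p ℕ.∸ p))
            ≡⟨ ≡.cong₂ (λ c k → c · (a ^ p * b ^ k)) (nCn≡1 p) (ℕ.n∸n≡0 p) ⟩
          1 · (a ^ p * 1#)                            ≈⟨ trans (×-homo-1 _) (*-identityʳ _) ⟩
          a ^ p                                       ∎
        middle : ∀ i → init inner i ≈ 0#
        middle i with p∣pCk {k = suc (toℕ (inject₁ i))} p-prime ℕ.z<s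
          (ℕ.s<s (≡.subst (ℕ._< suc m) (≡.sym (Fin.toℕ-inject₁ i)) (Fin.toℕ<n i)))
        ... | divides j pCk≡j*p =
          trans (reflexive (≡.cong (_· monomial) (≡.trans pCk≡j*p (ℕ.*-comm j p)))) (p*j·x≈0 j monomial)
          where
          monomial : Carrier
          monomial = Binomial.binomial a b p (Fin.suc (inject₁ i))

    frobenius-^ : ∀ l a b → (a + b) ^ (p ℕ.^ l) ≈ a ^ (p ℕ.^ l) + b ^ (p ℕ.^ l)
    frobenius-^ zero    a b = trans (*-identityʳ _) (sym (+-cong (*-identityʳ a) (*-identityʳ b)))
    frobenius-^ (suc l) a b = begin
      (a + b) ^ (p ℕ.* p ℕ.^ l)                  ≈⟨ ^-assocʳ (a + b) p (p ℕ.^ l) ⟨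
      ((a + b) ^ p) ^ (p ℕ.^ l)                  ≈⟨ ^-congˡ (p ℕ.^ l) (frobenius a b) ⟩
      (a ^ p + b ^ p) ^ (p ℕ.^ l)                ≈⟨ frobenius-^ l (a ^ p) (b ^ p) ⟩
      (a ^ p) ^ (p ℕ.^ l) + (b ^ p) ^ (p ℕ.^ l)  ≈⟨ +-cong (^-assocʳ a p (p ℕ.^ l)) (^-assocʳ b p (p ℕ.^ l)) ⟩
      a ^ (p ℕ.* p ℕ.^ l) + b ^ (p ℕ.* p ℕ.^ l)  ∎

    frobenius-^-neg : ∀ l a → (- a) ^ (p ℕ.^ l) ≈ - (a ^ (p ℕ.^ l))
    frobenius-^-neg l a = inverseʳ-unique _ _ (begin
      a ^ (p ℕ.^ l) + (- a) ^ (p ℕ.^ l)  ≈⟨ frobenius-^ l a (- a) ⟨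
      (a - a) ^ (p ℕ.^ l)                ≈⟨ ^-congˡ (p ℕ.^ l) (-‿inverseʳ a) ⟩
      0# ^ (p ℕ.^ l)                     ≈⟨ 0^n≈0 (p ℕ.^ l) {{ℕ.m^n≢0 p l {{prime⇒nonZero p-prime}}}} ⟩
      0#                                 ∎)
      where
      0^n≈0 : ∀ n → .{{ℕ.NonZero n}} → 0# ^ n ≈ 0#
      0^n≈0 (suc n) = zeroˡ _

    two^[1+p^l]≈four : ∀ l → two ^ suc (p ℕ.^ l) ≈ four
    two^[1+p^l]≈four l = *-congˡ (trans (frobenius-^ l 1# 1#) (+-cong (1^n≈1 (p ℕ.^ l)) (1^n≈1 (p ℕ.^ l))))

    [1+s]^[1+p^l]-[1-s]^[1+p^l] : ∀ l {d} → p ℕ.^ l ≡ d ℕ.+ suc d →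
      ∀ s → (1# + s) ^ suc (p ℕ.^ l) - (1# - s) ^ suc (p ℕ.^ l) ≈ two * (s + s * (s * s) ^ d)
    [1+s]^[1+p^l]-[1-s]^[1+p^l] l {d} p^l≡d+[1+d] s = begin
      (1# + s) * (1# + s) ^ Q - (1# - s) * (1# - s) ^ Q
        ≈⟨ +-cong (*-congˡ (trans (frobenius-^ l 1# s) (+-congʳ (1^n≈1 Q))))
                  (-‿cong (*-congˡ (trans (frobenius-^ l 1# (- s)) (+-cong (1^n≈1 Q) (frobenius-^-neg l s))))) ⟩
      (1# + s) * (1# + s ^ Q) - (1# - s) * (1# - s ^ Q)
        ≈⟨ solve 2 (λ s S → (𝟙 :+ s) :* (𝟙 :+ S) :- (𝟙 :- s) :* (𝟙 :- S) := 𝟚 :* (s :+ S)) refl s (s ^ Q) ⟩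
      two * (s + s ^ Q)
        ≈⟨ *-congˡ (+-congˡ s^Q≈s*[s*s]^d) ⟩
      two * (s + s * (s * s) ^ d) ∎
      where
      Q : ℕ
      Q = p ℕ.^ l
      s^Q≈s*[s*s]^d : s ^ Q ≈ s * (s * s) ^ d
      s^Q≈s*[s*s]^d = begin
        s ^ Q                  ≡⟨ ≡.cong (s ^_) p^l≡d+[1+d] ⟩
        s ^ (d ℕ.+ suc d)      ≈⟨ ^-homo-* s d (suc d) ⟩
        s ^ d * (s * s ^ d)    ≈⟨ solve 2 (λ s y → y :* (s :* y) := s :* (y :* y)) refl s (s ^ d) ⟩
        s * (s ^ d * s ^ d)    ≈⟨ *-congˡ (^-distrib-* s s d) ⟨
        s * (s * s) ^ d        ∎

module QuadraticExtension {c ℓ} (R : CommutativeRing c ℓ) (t : CommutativeRing.Carrier R) where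

  open import Data.Product.Base using (_×_)
  import Algebra.Construct.DirectProduct as DirectProduct
  open CommutativeRing R
  open RingSolver R using (solve; _:=_; _:+_; _:*_; con; Polynomial)

  private
    𝟘 𝟙 : ∀ {n} → Polynomial n
    𝟘 = con (+ 0)
    𝟙 = con (+ 1)

    module R² = AbelianGroup (DirectProduct.abelianGroup +-abelianGroup +-abelianGroup)

    -- (a , b) stands for a + b √t.
    _*′_ : Carrier × Carrier → Carrier × Carrier → Carrier × Carrier
    (a , b) *′ (c , d) = a * c + t * (b * d) , a * d + b * c

  R[√t] : CommutativeRing c ℓ
  R[√t] = record
    { Carrier = Carrier × Carrier
    ; _≈_ = R²._≈_
    ; _+_ = R²._∙_
    ; _*_ = _*′_
    ; -_ = R²._⁻¹
    ; 0# = R².ε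
    ; 1# = 1# , 0#
    ; isCommutativeRing = record
      { isRing = record
        { +-isAbelianGroup = R².isAbelianGroup
        ; *-cong = λ (a≈a′ , b≈b′) (c≈c′ , d≈d′) →
            +-cong (*-cong a≈a′ c≈c′) (*-congˡ (*-cong b≈b′ d≈d′)) ,
            +-cong (*-cong a≈a′ d≈d′) (*-cong b≈b′ c≈c′)
        ; *-assoc = λ (a , b) (c , d) (e , f) →
            solve 7 (λ a b c d e f t → (a :* c :+ t :* (b :* d)) :* e :+ t :* ((a :* d :+ b :* c) :* f)
                                  := a :* (c :* e :+ t :* (d :* f)) :+ t :* (b :* (c :* f :+ d :* e))) refl a b c d e f t ,
            solve 7 (λ a b c d e f t → (a :* c :+ t :* (b :* d)) :* f :+ (a :* d :+ b :* c) :* e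
                                  := a :* (c :* f :+ d :* e) :+ b :* (c :* e :+ t :* (d :* f))) refl a b c d e f t
        ; *-identity =
            (λ (a , b) → solve 3 (λ a b t → 𝟙 :* a :+ t :* (𝟘 :* b) := a) refl a b t ,
                         solve 2 (λ a b → 𝟙 :* b :+ 𝟘 :* a := b) refl a b) ,
            (λ (a , b) → solve 3 (λ a b t → a :* 𝟙 :+ t :* (b :* 𝟘) := a) refl a b t ,
                         solve 2 (λ a b → a :* 𝟘 :+ b :* 𝟙 := b) refl a b)
        ; distrib =
            (λ (a , b) (c , d) (e , f) →
              solve 7 (λ a b c d e f t → a :* (c :+ e) :+ t :* (b :* (d :+ f))
                                    := (a :* c :+ t :* (b :* d)) :+ (a :* e :+ t :* (b :* f))) refl a b c d e f t ,
              solve 6 (λ a b c d e f → a :* (d :+ f) :+ b :* (c :+ e) := (a :* d :+ b :* c) :+ (a :* f :+ b :* e))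
                refl a b c d e f) ,
            (λ (a , b) (c , d) (e , f) →
              solve 7 (λ a b c d e f t → (c :+ e) :* a :+ t :* ((d :+ f) :* b)
                                    := (c :* a :+ t :* (d :* b)) :+ (e :* a :+ t :* (f :* b))) refl a b c d e f t ,
              solve 6 (λ a b c d e f → (c :+ e) :* b :+ (d :+ f) :* a := (c :* b :+ d :* a) :+ (e :* b :+ f :* a))
                refl a b c d e f)
        }
      ; *-comm = λ (a , b) (c , d) →
          solve 5 (λ a b c d t → a :* c :+ t :* (b :* d) := c :* a :+ t :* (d :* b)) refl a b c d t ,
          solve 4 (λ a b c d → a :* d :+ b :* c := c :* b :+ d :* a) refl a b c d
      }
    }

  private
    module R′ = CommutativeRing R[√t]

  open RawSemiring (Semiring.rawSemiring semiring) using (_^_) renaming (_×_ to _·_)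
  open RawSemiring (Semiring.rawSemiring R′.semiring) using () renaming (_^_ to _^′_; _×_ to _·′_)
  open import Algebra.Properties.Ring ring using (-0#≈0#)

  ι : Carrier → Carrier × Carrier
  ι a = a , 0#

  √t : Carrier × Carrier
  √t = 0# , 1#

  ι-cong : ∀ {a b} → a ≈ b → ι a R′.≈ ι b
  ι-cong a≈b = a≈b , refl

  ι-+ : ∀ a b → ι (a + b) R′.≈ ι a R′.+ ι b
  ι-+ a b = refl , sym (+-identityʳ 0#)

  ι-* : ∀ a b → ι (a * b) R′.≈ ι a R′.* ι b
  ι-* a b = solve 3 (λ a b t → a :* b := a :* b :+ t :* (𝟘 :* 𝟘)) refl a b t ,
            solve 2 (λ a b → 𝟘 := a :* 𝟘 :+ 𝟘 :* b) refl a b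

  ι-neg : ∀ a → ι (- a) R′.≈ R′.- ι a
  ι-neg a = refl , sym -0#≈0#

  ι-^ : ∀ a n → ι (a ^ n) R′.≈ ι a ^′ n
  ι-^ a zero    = R′.refl
  ι-^ a (suc n) = R′.trans (ι-* a (a ^ n)) (R′.*-congˡ (ι-^ a n))

  ι-· : ∀ n a → ι (n · a) R′.≈ n ·′ ι a
  ι-· zero    a = R′.refl
  ι-· (suc n) a = R′.trans (ι-+ a (n · a)) (R′.+-congˡ (ι-· n a))

  √t*√t≈ιt : √t R′.* √t R′.≈ ι t
  √t*√t≈ιt = solve 1 (λ t → 𝟘 :* 𝟘 :+ t :* (𝟙 :* 𝟙) := t) refl t , solve 0 (𝟘 :* 𝟙 :+ 𝟙 :* 𝟘 := 𝟘) refl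

  √t*ι-injective : ∀ {a b} → √t R′.* ι a R′.≈ √t R′.* ι b → a ≈ b
  √t*ι-injective {a} {b} (_ , eq) = trans (sym (coefficient a)) (trans eq (coefficient b))
    where
    coefficient : ∀ a → 0# * 0# + 1# * a ≈ a
    coefficient = solve 1 (λ a → 𝟘 :* 𝟘 :+ 𝟙 :* a := a) refl

module FieldProperties {c ℓ : Level} {q : ℕ} (F : FiniteField c ℓ q) where

  open import Data.Nat.DivMod using (m≡m%n+[m/n]*n)
  open import Function.Definitions using (Congruent; Injective; Bijective)
  open import Function.Consequences.Setoid using (strictlySurjective⇒surjective)
  open FiniteField F
  open RawSemiring (Semiring.rawSemiring semiring) using () renaming (_×_ to _·_)
  open import Algebra.Properties.Semiring.Mult semiring using (×-homo-+; ×1-homo-*)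
  open import Algebra.Properties.Group +-group using (∙-cancelˡ; ⁻¹-injective)
  open RingSolver commRing using (solve; _:=_; _:+_; _:*_; _:-_; con; Polynomial)
  open CommutativeRingProperties commRing using (two; four)
  open import Relation.Binary.Reasoning.Setoid setoid

  *-cancelˡ : ∀ {a b c} → ¬ a ≈ 0# → a * b ≈ a * c → b ≈ c
  *-cancelˡ {a} {b} {c} a≉0 ab≈ac = begin
    b                ≈⟨ *-identityˡ b ⟨
    1# * b           ≈⟨ *-congʳ a⁻¹*a≈1 ⟨
    (a⁻¹ * a) * b    ≈⟨ *-assoc a⁻¹ a b ⟩
    a⁻¹ * (a * b)    ≈⟨ *-congˡ ab≈ac ⟩
    a⁻¹ * (a * c)    ≈⟨ *-assoc a⁻¹ a c ⟨
    (a⁻¹ * a) * c    ≈⟨ *-congʳ a⁻¹*a≈1 ⟩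
    1# * c           ≈⟨ *-identityˡ c ⟩
    c                ∎
    where
    a⁻¹ : Carrier
    a⁻¹ = proj₁ (inverse a a≉0)
    a⁻¹*a≈1 : a⁻¹ * a ≈ 1#
    a⁻¹*a≈1 = trans (*-comm a⁻¹ a) (proj₂ (inverse a a≉0))

  *-nonzero : ∀ {a b} → ¬ a ≈ 0# → ¬ b ≈ 0# → ¬ a * b ≈ 0#
  *-nonzero {a} {b} a≉0 b≉0 ab≈0 = b≉0 (*-cancelˡ a≉0 (trans ab≈0 (sym (zeroʳ a))))

  odd-char⇒two≉0 : ∀ p → p ℕ.% 2 ≡ 1 → HasChar F p → ¬ two ≈ 0#
  odd-char⇒two≉0 p p-odd char-p two≈0 = 1≉0 (begin
    1#                             ≈⟨ +-identityʳ 1# ⟨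
    1# + 0#                        ≈⟨ +-congˡ (zeroʳ (h · 1#)) ⟨
    1# + (h · 1#) * 0#             ≈⟨ +-cong (+-identityʳ 1#) (*-congˡ (trans (+-congˡ (+-identityʳ 1#)) two≈0)) ⟨
    1 · 1# + (h · 1#) * (2 · 1#)   ≈⟨ +-congˡ (×1-homo-* h 2) ⟨
    1 · 1# + (h ℕ.* 2) · 1#        ≈⟨ ×-homo-+ 1# 1 (h ℕ.* 2) ⟨
    (1 ℕ.+ h ℕ.* 2) · 1#           ≡⟨ ≡.cong (_· 1#) p≡1+h*2 ⟨
    p · 1#                         ≈⟨ char-p ⟩
    0#                             ∎)
    where
    h : ℕ
    h = p ℕ./ 2
    p≡1+h*2 : p ≡ 1 ℕ.+ h ℕ.* 2
    p≡1+h*2 = ≡.trans (m≡m%n+[m/n]*n p 2) (≡.cong (ℕ._+ h ℕ.* 2) p-odd)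

  module _ {f g : Carrier → Carrier} (two≉0 : ¬ two ≈ 0#) (g-cong : Congruent _≈_ _≈_ g)
           (2f≈1+g[1-4x] : ∀ x → two * f x ≈ 1# + g (1# - four * x)) where

    private
      𝟙 : ∀ {n} → Polynomial n
      𝟙 = con (+ 1)

      four⁻¹ : Carrier
      four⁻¹ = proj₁ (inverse four (*-nonzero two≉0 two≉0))

      φ : Carrier → Carrier
      φ x = 1# - four * x

      φ⁻¹ : Carrier → Carrier
      φ⁻¹ y = four⁻¹ * (1# - y)

      φ-cong : ∀ {x y} → x ≈ y → φ x ≈ φ y
      φ-cong x≈y = +-congˡ (-‿cong (*-congˡ x≈y))

      φ-injective : ∀ {x y} → φ x ≈ φ y → x ≈ y
      φ-injective φx≈φy = *-cancelˡ (*-nonzero two≉0 two≉0) (⁻¹-injective (∙-cancelˡ 1# _ _ φx≈φy))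

      φ∘φ⁻¹ : ∀ y → φ (φ⁻¹ y) ≈ y
      φ∘φ⁻¹ y = begin
        1# - four * (four⁻¹ * (1# - y))   ≈⟨ +-congˡ (-‿cong (*-assoc four four⁻¹ _)) ⟨
        1# - (four * four⁻¹) * (1# - y)   ≈⟨ +-congˡ (-‿cong (*-congʳ (proj₂ (inverse four _)))) ⟩
        1# - 1# * (1# - y)                ≈⟨ solve 1 (λ y → 𝟙 :- 𝟙 :* (𝟙 :- y) := y) refl y ⟩
        y                                 ∎

      f≈f⇒g∘φ≈g∘φ : ∀ {x y} → f x ≈ f y → g (φ x) ≈ g (φ y)
      f≈f⇒g∘φ≈g∘φ {x} {y} fx≈fy =
        ∙-cancelˡ 1# _ _ (trans (sym (2f≈1+g[1-4x] x)) (trans (*-congˡ fx≈fy) (2f≈1+g[1-4x] y)))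

      g∘φ≈g∘φ⇒f≈f : ∀ {x y} → g (φ x) ≈ g (φ y) → f x ≈ f y
      g∘φ≈g∘φ⇒f≈f {x} {y} gφx≈gφy =
        *-cancelˡ two≉0 (trans (2f≈1+g[1-4x] x) (trans (+-congˡ gφx≈gφy) (sym (2f≈1+g[1-4x] y))))

    injective⇒injective : Injective _≈_ _≈_ f → Injective _≈_ _≈_ g
    injective⇒injective f-injective {y} {z} gy≈gz = begin
      y              ≈⟨ φ∘φ⁻¹ y ⟨
      φ (φ⁻¹ y)      ≈⟨ φ-cong (f-injective (g∘φ≈g∘φ⇒f≈f g[φ[φ⁻¹y]]≈g[φ[φ⁻¹z]])) ⟩
      φ (φ⁻¹ z)      ≈⟨ φ∘φ⁻¹ z ⟩
      z              ∎
      where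
      g[φ[φ⁻¹y]]≈g[φ[φ⁻¹z]] : g (φ (φ⁻¹ y)) ≈ g (φ (φ⁻¹ z))
      g[φ[φ⁻¹y]]≈g[φ[φ⁻¹z]] = trans (g-cong (φ∘φ⁻¹ y)) (trans gy≈gz (sym (g-cong (φ∘φ⁻¹ z))))

    bijective⇒bijective : Bijective _≈_ _≈_ g → Bijective _≈_ _≈_ f
    bijective⇒bijective (g-injective , g-surjective) =
      (λ fx≈fy → φ-injective (g-injective (f≈f⇒g∘φ≈g∘φ fx≈fy))) ,
      strictlySurjective⇒surjective setoid setoid (λ x≈y → g∘φ≈g∘φ⇒f≈f (g-cong (φ-cong x≈y))) preimage
      where
      preimage : ∀ z → Σ Carrier (λ x → f x ≈ z)
      preimage z with g-surjective (two * z - 1#)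
      ... | y , g[y]≈2z-1 = φ⁻¹ y , *-cancelˡ two≉0 (begin
        two * f (φ⁻¹ y)       ≈⟨ 2f≈1+g[1-4x] (φ⁻¹ y) ⟩
        1# + g (φ (φ⁻¹ y))    ≈⟨ +-congˡ (g[y]≈2z-1 (φ∘φ⁻¹ y)) ⟩
        1# + (two * z - 1#)   ≈⟨ solve 2 (λ w z → 𝟙 :+ (w :* z :- 𝟙) := w :* z) refl two z ⟩
        two * z               ∎)

module DicksonPolynomials {c ℓ : Level} {q : ℕ} (F : FiniteField c ℓ q) where

  open import Data.Nat.Base using (_∸_; _≤_; _<_; z≤n; s≤s)
  open import Data.Nat.Combinatorics using (_C_; k>n⇒nCk≡0)
  open import Data.Nat.DivMod using (m*n/n≡m)
  open import Data.Nat.Tactic.RingSolver using (solve-∀)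
  open BinomialCoefficients using ([1+n∸k]C[1+k]≡[n∸k]Ck+[n∸k]C[1+k]; dicksonCoeff[1+m,2,i]≡[m∸i]Ci)
  open FiniteField F
  open RawSemiring (Semiring.rawSemiring semiring) using (_^_) renaming (_×_ to _·_)
  open import Algebra.Properties.Ring ring using (-‿distribˡ-*)
  open import Algebra.Properties.Semiring.Mult semiring using (×-homo-+)
  open import Relation.Binary.Reasoning.Setoid setoid
  open RingSolver commRing using (solve; _:=_; _:+_; _:*_)

  sumTo-cong : ∀ m {f g} → (∀ i → i ≤ m → f i ≈ g i) → sumTo F m f ≈ sumTo F m g
  sumTo-cong zero    f≈g = f≈g 0 z≤n
  sumTo-cong (suc m) f≈g = +-cong (sumTo-cong m (λ i i≤m → f≈g i (ℕ.m≤n⇒m≤1+n i≤m))) (f≈g (suc m) ℕ.≤-refl)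

  sumTo-suc : ∀ m f → sumTo F (suc m) f ≈ f 0 + sumTo F m (λ i → f (suc i))
  sumTo-suc zero    f = refl
  sumTo-suc (suc m) f = trans (+-congʳ (sumTo-suc m f)) (+-assoc _ _ _)

  sumTo-+ : ∀ m f g → sumTo F m (λ i → f i + g i) ≈ sumTo F m f + sumTo F m g
  sumTo-+ zero    f g = refl
  sumTo-+ (suc m) f g = trans (+-congʳ (sumTo-+ m f g))
    (solve 4 (λ a b c d → (a :+ b) :+ (c :+ d) := (a :+ c) :+ (b :+ d)) refl _ _ _ _)

  sumTo-*ˡ : ∀ m a f → a * sumTo F m f ≈ sumTo F m (λ i → a * f i)
  sumTo-*ˡ zero    a f = refl
  sumTo-*ˡ (suc m) a f = trans (distribˡ a _ _) (+-congʳ (sumTo-*ˡ m a f))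

  sumTo-zeros : ∀ k m f → (∀ i → m < i → f i ≈ 0#) → sumTo F (k ℕ.+ m) f ≈ sumTo F m f
  sumTo-zeros zero    m f f≈0 = refl
  sumTo-zeros (suc k) m f f≈0 =
    trans (+-cong (sumTo-zeros k m f f≈0) (f≈0 (suc (k ℕ.+ m)) (s≤s (ℕ.m≤n+m m k)))) (+-identityʳ _)

  E-term : ℕ → Carrier → ℕ → Carrier
  E-term n x i = ((n ∸ i) C i) · 1# * (- x) ^ i

  E : ℕ → Carrier → Carrier
  E n x = sumTo F n (E-term n x)

  E-term-vanishes : ∀ n x i → n ∸ i < i → E-term n x i ≈ 0#
  E-term-vanishes n x i [n∸i]<i = trans (*-congʳ (reflexive (≡.cong (_· 1#) (k>n⇒nCk≡0 [n∸i]<i)))) (zeroˡ _)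

  E-term-vanishes-beyond : ∀ n x i → n < i → E-term n x i ≈ 0#
  E-term-vanishes-beyond n x i n<i = E-term-vanishes n x i (ℕ.≤-<-trans (ℕ.m∸n≤m n i) n<i)

  E-0 : ∀ x → E 0 x ≈ 1#
  E-0 x = trans (*-identityʳ _) (+-identityʳ 1#)

  E-1 : ∀ x → E 1 x ≈ 1#
  E-1 x = trans (+-cong (E-0 x) (zeroˡ _)) (+-identityʳ 1#)

  E-rec : ∀ n x → E (suc (suc n)) x ≈ E (suc n) x - x * E n x
  E-rec n x = begin
    E (suc (suc n)) x                                                     ≈⟨ sumTo-suc (suc n) (E-term (suc (suc n)) x) ⟩
    E-term (suc (suc n)) x 0 + sumTo F (suc n) (λ i → E-term (suc (suc n)) x (suc i))
      ≈⟨ +-congˡ (sumTo-cong (suc n) (λ i _ → pascal i)) ⟩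
    E-term (suc n) x 0 + sumTo F (suc n) (λ i → E-term (suc n) x (suc i) + - x * E-term n x i)
      ≈⟨ +-congˡ (sumTo-+ (suc n) _ _) ⟩
    E-term (suc n) x 0 + (sumTo F (suc n) (λ i → E-term (suc n) x (suc i)) + sumTo F (suc n) (λ i → - x * E-term n x i))
      ≈⟨ +-assoc _ _ _ ⟨
    (E-term (suc n) x 0 + sumTo F (suc n) (λ i → E-term (suc n) x (suc i))) + sumTo F (suc n) (λ i → - x * E-term n x i)
      ≈⟨ +-cong (sumTo-suc (suc n) (E-term (suc n) x)) (sumTo-*ˡ (suc n) (- x) (E-term n x)) ⟨
    sumTo F (suc (suc n)) (E-term (suc n) x) + - x * sumTo F (suc n) (E-term n x)
      ≈⟨ +-cong (sumTo-zeros 1 (suc n) _ (E-term-vanishes-beyond (suc n) x))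
                (*-congˡ (sumTo-zeros 1 n _ (E-term-vanishes-beyond n x))) ⟩
    E (suc n) x + - x * E n x                                       ≈⟨ +-congˡ (-‿distribˡ-* x _) ⟨
    E (suc n) x - x * E n x                                         ∎
    where
    pascal : ∀ i → E-term (suc (suc n)) x (suc i) ≈ E-term (suc n) x (suc i) + - x * E-term n x i
    pascal i = begin
      ((suc n ∸ i) C suc i) · 1# * (- x) ^ suc i
        ≡⟨ ≡.cong (λ k → k · 1# * (- x) ^ suc i) ([1+n∸k]C[1+k]≡[n∸k]Ck+[n∸k]C[1+k] n i) ⟩
      ((n ∸ i) C i ℕ.+ (n ∸ i) C suc i) · 1# * (- x) ^ suc i
        ≈⟨ *-congʳ (×-homo-+ 1# ((n ∸ i) C i) ((n ∸ i) C suc i)) ⟩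
      (((n ∸ i) C i) · 1# + ((n ∸ i) C suc i) · 1#) * (- x * (- x) ^ i)
        ≈⟨ solve 4 (λ a b y z → (a :+ b) :* (y :* z) := b :* (y :* z) :+ y :* (a :* z)) refl _ _ _ _ ⟩
      E-term (suc n) x (suc i) + - x * E-term n x i ∎

  D[2+2d]≈E[1+2d] : ∀ d x → D F (suc (d ℕ.+ suc d)) 2 x ≈ E (d ℕ.+ suc d) x
  D[2+2d]≈E[1+2d] d x = begin
    sumTo F (suc n ℕ./ 2) (λ i → fromℤ F (dicksonCoeff (suc n) 2 i) * (- x) ^ i)
      ≡⟨ ≡.cong (λ m → sumTo F m (λ i → fromℤ F (dicksonCoeff (suc n) 2 i) * (- x) ^ i)) [2+2d]/2≡1+d ⟩
    sumTo F (suc d) (λ i → fromℤ F (dicksonCoeff (suc n) 2 i) * (- x) ^ i)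
      ≈⟨ sumTo-cong (suc d) (λ i i≤1+d → reflexive (≡.cong (λ c → fromℤ F c * (- x) ^ i)
           (dicksonCoeff[1+m,2,i]≡[m∸i]Ci n i (ℕ.+-mono-≤ i≤1+d i≤1+d)))) ⟩
    sumTo F (suc d) (E-term n x)
      ≈⟨ sumTo-zeros d (suc d) (E-term n x) vanishes ⟨
    E n x ∎
    where
    n : ℕ
    n = d ℕ.+ suc d
    [2+2d]/2≡1+d : suc n ℕ./ 2 ≡ suc d
    [2+2d]/2≡1+d = ≡.trans (≡.cong (ℕ._/ 2) (2+2d≡[1+d]*2 d)) (m*n/n≡m (suc d) 2)
      where
      2+2d≡[1+d]*2 : ∀ d → suc (d ℕ.+ suc d) ≡ suc d ℕ.* 2
      2+2d≡[1+d]*2 = solve-∀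
    vanishes : ∀ i → suc d < i → E-term n x i ≈ 0#
    vanishes i 1+d<i = E-term-vanishes n x i (ℕ.≤-<-trans (ℕ.∸-monoʳ-≤ n (ℕ.<⇒≤ 1+d<i))
      (≡.subst (_< i) (≡.sym (ℕ.m+n∸n≡m d (suc d))) (ℕ.<-trans (ℕ.n<1+n d) 1+d<i)))

module ClosedForm {c ℓ : Level} {q : ℕ} (F : FiniteField c ℓ q) {p : ℕ} (p-prime : Prime p) (char-p : HasChar F p) where

  import Relation.Binary.Reasoning.Setoid as SetoidReasoning
  open DicksonPolynomials F using (E; E-0; E-1; E-rec; D[2+2d]≈E[1+2d])
  open FieldProperties F using (*-cancelˡ)

  private
    module 𝔽 where
      open FiniteField F public
      open RawSemiring (Semiring.rawSemiring semiring) public using (_^_)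
      open CommutativeRingProperties commRing public using (two; four)

    module InExtension {l d} (p^l≡d+[1+d] : p ℕ.^ l ≡ d ℕ.+ suc d) (x : 𝔽.Carrier) where
      Q : ℕ
      Q = p ℕ.^ l
      t : 𝔽.Carrier
      t = 𝔽.1# 𝔽.- 𝔽.four 𝔽.* x
      open QuadraticExtension 𝔽.commRing t public using (√t; ι; √t*ι-injective)
      open QuadraticExtension 𝔽.commRing t using (R[√t]; ι-cong; ι-+; ι-*; ι-neg; ι-^; ι-·; √t*√t≈ιt)
      open CommutativeRing R[√t]
      open RawSemiring (Semiring.rawSemiring semiring) using (_^_)
      open CommutativeRingProperties R[√t] using (binet) renaming (two to two′; four to four′)
      open CommutativeRingProperties.Frobenius R[√t] p-prime (trans (sym (ι-· p 𝔽.1#)) (ι-cong char-p))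
        using (two^[1+p^l]≈four; [1+s]^[1+p^l]-[1-s]^[1+p^l])
      open RingSolver R[√t] using (solve; _:=_; _:+_; _:*_; con)
      open import Algebra.Properties.Semiring.Exp semiring using (^-congˡ)
      open SetoidReasoning setoid

      ι-two : ι 𝔽.two ≈ two′
      ι-two = ι-+ 𝔽.1# 𝔽.1#

      ι-four : ι 𝔽.four ≈ four′
      ι-four = trans (ι-* 𝔽.two 𝔽.two) (*-cong ι-two ι-two)

      √t*√t≈1-4ιx : √t * √t ≈ 1# - four′ * ι x
      √t*√t≈1-4ιx = begin
        √t * √t                         ≈⟨ √t*√t≈ιt ⟩
        ι (𝔽.1# 𝔽.- 𝔽.four 𝔽.* x)       ≈⟨ ι-+ 𝔽.1# _ ⟩
        1# + ι (𝔽.- (𝔽.four 𝔽.* x))     ≈⟨ +-congˡ (trans (ι-neg _) (-‿cong (trans (ι-* 𝔽.four x) (*-congʳ ι-four)))) ⟩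
        1# - four′ * ι x                ∎

      ι-E-rec : ∀ n → ι (E (suc (suc n)) x) ≈ ι (E (suc n) x) - ι x * ι (E n x)
      ι-E-rec n = trans (ι-cong (E-rec n x)) (trans (ι-+ _ _) (+-congˡ (trans (ι-neg _) (-‿cong (ι-* x (E n x))))))

      √t*ι[4E]≈√t*ι[2[1+t^d]] : √t * ι (𝔽.four 𝔽.* E Q x) ≈ √t * ι (𝔽.two 𝔽.* (𝔽.1# 𝔽.+ t 𝔽.^ d))
      √t*ι[4E]≈√t*ι[2[1+t^d]] = begin
        √t * ι (𝔽.four 𝔽.* E Q x)                ≈⟨ *-congˡ (trans (ι-* 𝔽.four (E Q x)) (*-congʳ ι-four)) ⟩
        √t * (four′ * ι (E Q x))
          ≈⟨ solve 3 (λ s f e → s :* (f :* e) := f :* (s :* e)) refl √t four′ (ι (E Q x)) ⟩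
        four′ * (√t * ι (E Q x))
          ≈⟨ *-congʳ (two^[1+p^l]≈four l) ⟨
        two′ ^ suc Q * (√t * ι (E Q x))
          ≈⟨ binet √t*√t≈1-4ιx (ι-cong (E-0 x)) (ι-cong (E-1 x)) ι-E-rec Q ⟩
        (1# + √t) ^ suc Q - (1# - √t) ^ suc Q
          ≈⟨ [1+s]^[1+p^l]-[1-s]^[1+p^l] l p^l≡d+[1+d] √t ⟩
        two′ * (√t + √t * (√t * √t) ^ d)
          ≈⟨ *-congˡ (+-congˡ (*-congˡ (trans (^-congˡ d √t*√t≈ιt) (sym (ι-^ t d))))) ⟩
        two′ * (√t + √t * ι (t 𝔽.^ d))
          ≈⟨ solve 3 (λ w s y → w :* (s :+ s :* y) := s :* (w :* (con (+ 1) :+ y))) refl two′ √t (ι (t 𝔽.^ d)) ⟩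
        √t * (two′ * (1# + ι (t 𝔽.^ d)))
          ≈⟨ *-congˡ (trans (ι-* 𝔽.two _) (*-cong ι-two (ι-+ 𝔽.1# (t 𝔽.^ d)))) ⟨
        √t * ι (𝔽.two 𝔽.* (𝔽.1# 𝔽.+ t 𝔽.^ d))   ∎

  open FiniteField F
  open RawSemiring (Semiring.rawSemiring semiring) using (_^_)
  open CommutativeRingProperties commRing using (two; four)
  open SetoidReasoning setoid

  two*E[p^l]≈1+[1-4x]^d : ∀ l {d} → p ℕ.^ l ≡ d ℕ.+ suc d → ¬ two ≈ 0# →
                          ∀ x → two * E (p ℕ.^ l) x ≈ 1# + (1# - four * x) ^ d
  two*E[p^l]≈1+[1-4x]^d l {d} p^l≡d+[1+d] two≉0 x = *-cancelˡ two≉0 (begin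
    two * (two * E (p ℕ.^ l) x)    ≈⟨ *-assoc two two _ ⟨
    four * E (p ℕ.^ l) x           ≈⟨ √t*ι-injective √t*ι[4E]≈√t*ι[2[1+t^d]] ⟩
    two * (1# + (1# - four * x) ^ d) ∎)
    where open InExtension {l} p^l≡d+[1+d] x

  two*D[p^l+1]≈1+[1-4x]^d : ∀ l {d} → p ℕ.^ l ≡ d ℕ.+ suc d → ¬ two ≈ 0# →
                            ∀ x → two * D F (p ℕ.^ l ℕ.+ 1) 2 x ≈ 1# + (1# - four * x) ^ d
  two*D[p^l+1]≈1+[1-4x]^d l {d} p^l≡d+[1+d] two≉0 x = begin
    two * D F (p ℕ.^ l ℕ.+ 1) 2 x
      ≡⟨ ≡.cong (λ m → two * D F m 2 x) (≡.trans (ℕ.+-comm (p ℕ.^ l) 1) (≡.cong suc p^l≡d+[1+d])) ⟩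
    two * D F (suc (d ℕ.+ suc d)) 2 x  ≈⟨ *-congˡ (D[2+2d]≈E[1+2d] d x) ⟩
    two * E (d ℕ.+ suc d) x            ≡⟨ ≡.cong (λ m → two * E m x) p^l≡d+[1+d] ⟨
    two * E (p ℕ.^ l) x                ≈⟨ two*E[p^l]≈1+[1-4x]^d l p^l≡d+[1+d] two≉0 x ⟩
    1# + (1# - four * x) ^ d           ∎

module FiniteFieldProperties {c ℓ : Level} {N : ℕ} (F : FiniteField c ℓ (suc N)) where

  open import Data.Fin.Base as Fin using (Fin; punchIn)
  import Data.Fin.Properties as Fin
  open import Data.Fin.Permutation using (permutation)
  open import Data.Product.Base using (_×_)
  open import Data.Empty using (⊥-elim)
  open import Relation.Binary.Definitions using (Decidable)
  open import Data.Nat.GCD using (gcd; gcd[m,n]∣m; gcd[m,n]∣n)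
  open import Data.Nat.Divisibility using (divides)
  open import Data.Nat.Tactic.RingSolver using (solve-∀)
  open import Function.Definitions using (Injective; Bijective)
  open Arithmetic using (coprime⇒∃inverse)
  open FiniteField F
  open RawSemiring (Semiring.rawSemiring semiring) using (_^_)
  open import Algebra.Properties.CommutativeMonoid.Sum *-commutativeMonoid
    using () renaming (sum to product; sum-remove to product-remove; ∑-distrib-+ to product-distrib;
                       sum-permute to product-permute; sum-cong-≋ to product-cong; sum-replicate to product-replicate)
  open import Algebra.Properties.Semiring.Exp semiring using (^-congˡ; ^-assocʳ)
  open import Algebra.Properties.Group +-group using (x∙y⁻¹≈ε⇒x≈y)
  open import Function.Consequences.Setoid setoid setoid using (strictlySurjective⇒surjective)
  open import Relation.Binary.Reasoning.Setoid setoid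
  open RingSolver commRing using (solve; _:=_; _:+_; _:*_; _:-_)
  open CommutativeRingProperties commRing using (1^n≈1)
  open FieldProperties F using (*-cancelˡ; *-nonzero)

  private
    index : Carrier → Fin (suc N)
    index a = proj₁ (proj₂ enum-bij a)

    enum-index : ∀ a → enum (index a) ≈ a
    enum-index a = proj₂ (proj₂ enum-bij a) ≡.refl

    enum-injective : ∀ {i j} → enum i ≈ enum j → i ≡ j
    enum-injective = proj₁ enum-bij

    index-cong : ∀ {a b} → a ≈ b → index a ≡ index b
    index-cong {a} {b} a≈b = enum-injective (trans (enum-index a) (trans a≈b (sym (enum-index b))))

  _≟_ : Decidable _≈_
  a ≟ b with index a Fin.≟ index b
  ... | yes i≡j = yes (trans (sym (enum-index a)) (trans (reflexive (≡.cong enum i≡j)) (enum-index b)))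
  ... | no  i≢j = no (λ a≈b → i≢j (index-cong a≈b))

  nonzero : Carrier → Carrier
  nonzero a with a ≟ 0#
  ... | yes _ = 1#
  ... | no  _ = a

  nonzero≉0 : ∀ a → ¬ nonzero a ≈ 0#
  nonzero≉0 a with a ≟ 0#
  ... | yes _   = 1≉0
  ... | no  a≉0 = a≉0

  nonzero-cong : ∀ {a b} → a ≈ b → nonzero a ≈ nonzero b
  nonzero-cong {a} {b} a≈b with a ≟ 0# | b ≟ 0#
  ... | yes _   | yes _   = refl
  ... | no  _   | no  _   = a≈b
  ... | yes a≈0 | no  b≉0 = ⊥-elim (b≉0 (trans (sym a≈b) a≈0))
  ... | no  a≉0 | yes b≈0 = ⊥-elim (a≉0 (trans a≈b b≈0))

  product-nonzero : ∀ {n} (f : Fin n → Carrier) → (∀ i → ¬ f i ≈ 0#) → ¬ product f ≈ 0#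
  product-nonzero {zero}  f _   = 1≉0
  product-nonzero {suc n} f f≉0 = *-nonzero (f≉0 Fin.zero) (product-nonzero (λ i → f (Fin.suc i)) (λ i → f≉0 (Fin.suc i)))

  -- Multiplication by a unit y permutes F and fixes 0, so the product of all nonzero a
  -- (with 0 counted as 1) is unchanged by it, yet picks up the factor y ^ N.
  fermat : ∀ {y} → ¬ y ≈ 0# → y ^ N ≈ 1#
  fermat {y} y≉0 = sym (*-cancelˡ (product-nonzero values (λ i → nonzero≉0 (enum i))) (begin
    product values * 1#                       ≈⟨ *-identityʳ _ ⟩
    product values                            ≈⟨ product-permute values (permutation σ τ στ τσ) ⟩
    product (λ i → values (σ i))
      ≈⟨ product-cong (λ i → trans (nonzero-cong (enum-index _)) (nonzero[y*a] (enum i))) ⟩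
    product (λ i → y-or-1 (enum i) * values i) ≈⟨ product-distrib (λ i → y-or-1 (enum i)) values ⟩
    product (λ i → y-or-1 (enum i)) * product values
      ≈⟨ *-congʳ (product-remove {i = index 0#} (λ i → y-or-1 (enum i))) ⟩
    (y-or-1 (enum (index 0#)) * product (λ j → y-or-1 (enum (punchIn (index 0#) j)))) * product values
      ≈⟨ *-congʳ (*-cong y-or-1[0] (trans (product-cong y-or-1[≉0]) (product-replicate N))) ⟩
    (1# * y ^ N) * product values             ≈⟨ *-congʳ (*-identityˡ _) ⟩
    y ^ N * product values                    ≈⟨ *-comm _ _ ⟩
    product values * y ^ N                    ∎))
    where
    y⁻¹ : Carrier
    y⁻¹ = proj₁ (inverse y y≉0)
    values : Fin (suc N) → Carrier
    values i = nonzero (enum i)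
    σ τ : Fin (suc N) → Fin (suc N)
    σ i = index (y * enum i)
    τ i = index (y⁻¹ * enum i)
    στ : ∀ i → σ (τ i) ≡ i
    στ i = enum-injective (begin
      enum (σ (τ i))        ≈⟨ enum-index _ ⟩
      y * enum (τ i)        ≈⟨ *-congˡ (enum-index _) ⟩
      y * (y⁻¹ * enum i)    ≈⟨ *-assoc _ _ _ ⟨
      (y * y⁻¹) * enum i    ≈⟨ *-congʳ (proj₂ (inverse y y≉0)) ⟩
      1# * enum i           ≈⟨ *-identityˡ _ ⟩
      enum i                ∎)
    τσ : ∀ i → τ (σ i) ≡ i
    τσ i = enum-injective (begin
      enum (τ (σ i))        ≈⟨ enum-index _ ⟩
      y⁻¹ * enum (σ i)      ≈⟨ *-congˡ (enum-index _) ⟩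
      y⁻¹ * (y * enum i)    ≈⟨ *-assoc _ _ _ ⟨
      (y⁻¹ * y) * enum i    ≈⟨ *-congʳ (trans (*-comm y⁻¹ y) (proj₂ (inverse y y≉0))) ⟩
      1# * enum i           ≈⟨ *-identityˡ _ ⟩
      enum i                ∎)
    y-or-1 : Carrier → Carrier
    y-or-1 a with a ≟ 0#
    ... | yes _ = 1#
    ... | no  _ = y
    nonzero[y*a] : ∀ a → nonzero (y * a) ≈ y-or-1 a * nonzero a
    nonzero[y*a] a with a ≟ 0# | (y * a) ≟ 0#
    ... | yes _   | yes _    = sym (*-identityˡ 1#)
    ... | no  _   | no  _    = refl
    ... | yes a≈0 | no ya≉0  = ⊥-elim (ya≉0 (trans (*-congˡ a≈0) (zeroʳ y)))
    ... | no  a≉0 | yes ya≈0 = ⊥-elim (*-nonzero y≉0 a≉0 ya≈0)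
    y-or-1[0] : y-or-1 (enum (index 0#)) ≈ 1#
    y-or-1[0] with enum (index 0#) ≟ 0#
    ... | yes _ = refl
    ... | no  e≉0 = ⊥-elim (e≉0 (enum-index 0#))
    y-or-1[≉0] : ∀ j → y-or-1 (enum (punchIn (index 0#) j)) ≈ y
    y-or-1[≉0] j with enum (punchIn (index 0#) j) ≟ 0#
    ... | yes e≈0 = ⊥-elim (Fin.punchInᵢ≢i (index 0#) j (enum-injective (trans e≈0 (sym (enum-index 0#)))))
    ... | no  _   = refl

  -- The factor theorem taken as the definition: f has degree ≤ n + 1 if at
  -- every point a it factors as f y = f a + (y - a) g y with g of degree ≤ n.
  Degree≤ : ℕ → (Carrier → Carrier) → Set (c ⊔ ℓ)
  Degree≤ zero    f = ∀ a b → f a ≈ f b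
  Degree≤ (suc n) f = ∀ a → Σ (Carrier → Carrier) λ g → Degree≤ n g × (∀ y → f y ≈ f a + (y - a) * g y)

  Degree≤-const : ∀ n b → Degree≤ n (λ _ → b)
  Degree≤-const zero    b _ _ = refl
  Degree≤-const (suc n) b a   = (λ _ → 0#) , Degree≤-const n 0# , λ y → sym (trans (+-congˡ (zeroʳ _)) (+-identityʳ b))

  Degree≤-suc : ∀ n {f} → Degree≤ n f → Degree≤ (suc n) f
  Degree≤-suc zero    {f} f-const a =
    (λ _ → 0#) , Degree≤-const 0 0# , λ y → trans (f-const y a) (sym (trans (+-congˡ (zeroʳ _)) (+-identityʳ _)))
  Degree≤-suc (suc n) f-deg a       = let (g , g-deg , f≈) = f-deg a in g , Degree≤-suc n g-deg , f≈

  Degree≤-+ : ∀ n {f g} → Degree≤ n f → Degree≤ n g → Degree≤ n (λ y → f y + g y)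
  Degree≤-+ zero    f-deg g-deg a b = +-cong (f-deg a b) (g-deg a b)
  Degree≤-+ (suc n) {f} {g} f-deg g-deg a =
    let (f′ , f′-deg , f≈) = f-deg a ; (g′ , g′-deg , g≈) = g-deg a in
    (λ y → f′ y + g′ y) , Degree≤-+ n f′-deg g′-deg ,
    λ y → trans (+-cong (f≈ y) (g≈ y))
      (solve 5 (λ A B D G H → (A :+ D :* G) :+ (B :+ D :* H) := (A :+ B) :+ D :* (G :+ H)) refl (f a) (g a) (y - a) (f′ y) (g′ y))

  Degree≤-*ˡ : ∀ n b {f} → Degree≤ n f → Degree≤ n (λ y → b * f y)
  Degree≤-*ˡ zero    b f-deg a a′ = *-congˡ (f-deg a a′)
  Degree≤-*ˡ (suc n) b {f} f-deg a =
    let (f′ , f′-deg , f≈) = f-deg a in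
    (λ y → b * f′ y) , Degree≤-*ˡ n b f′-deg ,
    λ y → trans (*-congˡ (f≈ y))
      (solve 4 (λ B A D G → B :* (A :+ D :* G) := B :* A :+ D :* (B :* G)) refl b (f a) (y - a) (f′ y))

  Degree≤-x* : ∀ n {f} → Degree≤ n f → Degree≤ (suc n) (λ y → y * f y)
  Degree≤-x* zero    {f} f-const a = f , f-const , λ y → begin
    y * f y                        ≈⟨ solve 3 (λ y a F → y :* F := a :* F :+ (y :- a) :* F) refl y a (f y) ⟩
    a * f y + (y - a) * f y        ≈⟨ +-congʳ (*-congˡ (f-const y a)) ⟩
    a * f a + (y - a) * f y        ∎
  Degree≤-x* (suc n) {f} f-deg a =
    let (g , g-deg , f≈) = f-deg a in
    (λ y → f y + a * g y) , Degree≤-+ (suc n) f-deg (Degree≤-*ˡ (suc n) a (Degree≤-suc n g-deg)) , λ y → begin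
    y * f y                             ≈⟨ solve 3 (λ y a F → y :* F := a :* F :+ (y :- a) :* F) refl y a (f y) ⟩
    a * f y + (y - a) * f y             ≈⟨ +-congʳ (*-congˡ (f≈ y)) ⟩
    a * (f a + (y - a) * g y) + (y - a) * f y
      ≈⟨ solve 5 (λ y a F A G → a :* (A :+ (y :- a) :* G) :+ (y :- a) :* F := a :* A :+ (y :- a) :* (F :+ a :* G))
                 refl y a (f y) (f a) (g y) ⟩
    a * f a + (y - a) * (f y + a * g y) ∎

  Degree≤-^ : ∀ k → Degree≤ k (_^ k)
  Degree≤-^ zero    _ _ = refl
  Degree≤-^ (suc k) = Degree≤-x* k (Degree≤-^ k)

  vanishes-everywhere : ∀ n {f} → Degree≤ n f → (r : Fin (suc n) → Carrier) → (∀ {i j} → r i ≈ r j → i ≡ j) →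
                        (∀ i → f (r i) ≈ 0#) → ∀ y → f y ≈ 0#
  vanishes-everywhere zero    f-const r _ f[r]≈0 y = trans (f-const y (r Fin.zero)) (f[r]≈0 Fin.zero)
  vanishes-everywhere (suc n) {f} f-deg r r-injective f[r]≈0 y = begin
    f y                        ≈⟨ f≈ y ⟩
    f a + (y - a) * g y        ≈⟨ +-cong (f[r]≈0 Fin.zero) (*-congˡ (g≈0 y)) ⟩
    0# + (y - a) * 0#          ≈⟨ trans (+-identityˡ _) (zeroʳ _) ⟩
    0#                         ∎
    where
    a : Carrier
    a = r Fin.zero
    g : Carrier → Carrier
    g = proj₁ (f-deg a)
    f≈ : ∀ y → f y ≈ f a + (y - a) * g y
    f≈ = proj₂ (proj₂ (f-deg a))
    g[r]≈0 : ∀ j → g (r (Fin.suc j)) ≈ 0#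
    g[r]≈0 j = *-cancelˡ r[1+j]-a≉0 (begin
      (r (Fin.suc j) - a) * g (r (Fin.suc j))         ≈⟨ +-identityˡ _ ⟨
      0# + (r (Fin.suc j) - a) * g (r (Fin.suc j))    ≈⟨ +-congʳ (f[r]≈0 Fin.zero) ⟨
      f a + (r (Fin.suc j) - a) * g (r (Fin.suc j))   ≈⟨ f≈ _ ⟨
      f (r (Fin.suc j))                               ≈⟨ f[r]≈0 (Fin.suc j) ⟩
      0#                                              ≈⟨ zeroʳ _ ⟨
      (r (Fin.suc j) - a) * 0#                        ∎)
      where
      r[1+j]-a≉0 : ¬ r (Fin.suc j) - a ≈ 0#
      r[1+j]-a≉0 d≈0 = Fin.0≢1+n (≡.sym (r-injective (x∙y⁻¹≈ε⇒x≈y _ _ d≈0)))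
    g≈0 : ∀ y → g y ≈ 0#
    g≈0 = vanishes-everywhere n (proj₁ (proj₂ (f-deg a))) (λ j → r (Fin.suc j))
            (λ r[1+i]≈r[1+j] → Fin.suc-injective (r-injective r[1+i]≈r[1+j])) g[r]≈0

  units-not-all-roots-of-y^k≈1 : ∀ k → 0 ℕ.< k → k ℕ.< N → ¬ (∀ y → ¬ y ≈ 0# → y ^ k ≈ 1#)
  units-not-all-roots-of-y^k≈1 k@(suc _) _ k<N y^k≈1 = 1≉0 (sym (x∙y⁻¹≈ε⇒x≈y 0# 1# (begin
    0# - 1#              ≈⟨ +-congʳ (zeroˡ _) ⟨
    0# ^ k - 1#          ≈⟨ vanishes-everywhere k f-deg r r-injective f[r]≈0 0# ⟩
    0#                   ∎)))
    where
    f : Carrier → Carrier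
    f y = y ^ k - 1#
    f-deg : Degree≤ k f
    f-deg = Degree≤-+ k (Degree≤-^ k) (Degree≤-const k (- 1#))
    r : Fin (suc k) → Carrier
    r j = enum (punchIn (index 0#) (Fin.inject≤ j k<N))
    r-injective : ∀ {i j} → r i ≈ r j → i ≡ j
    r-injective r[i]≈r[j] = Fin.inject≤-injective k<N k<N _ _ (Fin.punchIn-injective (index 0#) _ _ (enum-injective r[i]≈r[j]))
    f[r]≈0 : ∀ j → f (r j) ≈ 0#
    f[r]≈0 j = trans (+-congʳ (y^k≈1 (r j) r[j]≉0)) (-‿inverseʳ 1#)
      where
      r[j]≉0 : ¬ r j ≈ 0#
      r[j]≉0 r[j]≈0 = Fin.punchInᵢ≢i (index 0#) _ (enum-injective (trans r[j]≈0 (sym (enum-index 0#))))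

  y^[1+k*N]≈y : ∀ k y → y ^ suc (k ℕ.* N) ≈ y
  y^[1+k*N]≈y k y with y ≟ 0#
  ... | yes y≈0 = trans (*-congʳ y≈0) (trans (zeroˡ _) (sym y≈0))
  ... | no  y≉0 = begin
    y * y ^ (k ℕ.* N)     ≡⟨ ≡.cong (λ m → y * y ^ m) (ℕ.*-comm k N) ⟩
    y * y ^ (N ℕ.* k)     ≈⟨ *-congˡ (^-assocʳ y N k) ⟨
    y * (y ^ N) ^ k       ≈⟨ *-congˡ (trans (^-congˡ k (fermat y≉0)) (1^n≈1 k)) ⟩
    y * 1#                ≈⟨ *-identityʳ y ⟩
    y                     ∎

  ^-injective⇒coprime : ∀ e .{{_ : ℕ.NonZero N}} → Injective _≈_ _≈_ (_^ e) → gcd e N ≡ 1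
  ^-injective⇒coprime e ^e-injective with gcd e N | gcd[m,n]∣m e N | gcd[m,n]∣n e N
  ... | 0           | _               | divides k N≡k*0 =
    contradiction (≡.trans N≡k*0 (ℕ.*-zeroʳ k)) (ℕ.≢-nonZero⁻¹ N)
  ... | 1           | _               | _                     = ≡.refl
  ... | suc (suc g) | _               | divides zero N≡0      = contradiction N≡0 (ℕ.≢-nonZero⁻¹ N)
  ... | suc (suc g) | divides j e≡j*g | divides k@(suc _) N≡k*g =
    contradiction units-are-roots (units-not-all-roots-of-y^k≈1 k ℕ.z<s k<N)
    where
    k<N : k ℕ.< N
    k<N = ≡.subst (k ℕ.<_) (≡.sym N≡k*g) (ℕ.m<m*n k (suc (suc g)) (ℕ.s<s ℕ.z<s))
    units-are-roots : ∀ y → ¬ y ≈ 0# → y ^ k ≈ 1#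
    units-are-roots y y≉0 = ^e-injective (begin
      (y ^ k) ^ e                   ≈⟨ ^-assocʳ y k e ⟩
      y ^ (k ℕ.* e)                 ≡⟨ ≡.cong (λ m → y ^ (k ℕ.* m)) e≡j*g ⟩
      y ^ (k ℕ.* (j ℕ.* suc (suc g)))
        ≡⟨ ≡.cong (y ^_) (≡.trans (regroup k j (suc (suc g))) (≡.cong (ℕ._* j) (≡.sym N≡k*g))) ⟩
      y ^ (N ℕ.* j)                 ≈⟨ ^-assocʳ y N j ⟨
      (y ^ N) ^ j                   ≈⟨ trans (^-congˡ j (fermat y≉0)) (1^n≈1 j) ⟩
      1#                            ≈⟨ 1^n≈1 e ⟨
      1# ^ e                        ∎)
      where
      regroup : ∀ k j g → k ℕ.* (j ℕ.* g) ≡ k ℕ.* g ℕ.* j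
      regroup = solve-∀

  coprime⇒^-bijective : ∀ e .{{_ : ℕ.NonTrivial N}} → gcd e N ≡ 1 → Bijective _≈_ _≈_ (_^ e)
  coprime⇒^-bijective e gcd≡1 with coprime⇒∃inverse e N gcd≡1
  ... | a , k , e*a≡1+k*N = injective , strictlySurjective⇒surjective (^-congˡ e) (λ y → y ^ a , [y^a]^e≈y y)
    where
    [y^e]^a≈y : ∀ y → (y ^ e) ^ a ≈ y
    [y^e]^a≈y y = trans (^-assocʳ y e a) (trans (reflexive (≡.cong (y ^_) e*a≡1+k*N)) (y^[1+k*N]≈y k y))
    [y^a]^e≈y : ∀ y → (y ^ a) ^ e ≈ y
    [y^a]^e≈y y = begin
      (y ^ a) ^ e     ≈⟨ ^-assocʳ y a e ⟩
      y ^ (a ℕ.* e)   ≡⟨ ≡.cong (y ^_) (ℕ.*-comm a e) ⟩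
      y ^ (e ℕ.* a)   ≈⟨ ^-assocʳ y e a ⟨
      (y ^ e) ^ a     ≈⟨ [y^e]^a≈y y ⟩
      y               ∎
    injective : Injective _≈_ _≈_ (_^ e)
    injective {y} {z} y^e≈z^e = trans (sym ([y^e]^a≈y y)) (trans (^-congˡ a y^e≈z^e) ([y^e]^a≈y z))

module PermutationCriterion {c ℓ : Level} {n : ℕ} (F : FiniteField c ℓ (suc (suc (suc n))))
                            {p : ℕ} (p-prime : Prime p) (p-odd : p ℕ.% 2 ≡ 1) (char-p : HasChar F p) where

  open import Data.Nat.GCD using (gcd)
  open import Function.Bundles using (_⇔_; mk⇔)
  open FiniteField F
  open RawSemiring (Semiring.rawSemiring semiring) using (_^_)
  open import Algebra.Properties.Semiring.Exp semiring using (^-congˡ)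
  open CommutativeRingProperties commRing using (two; four)
  open Arithmetic using (odd-^; odd⇒n≡[n∸1]/2+[1+[n∸1]/2])
  open FieldProperties F using (odd-char⇒two≉0; injective⇒injective; bijective⇒bijective)
  open ClosedForm F p-prime char-p using (two*D[p^l+1]≈1+[1-4x]^d)
  open FiniteFieldProperties F using (^-injective⇒coprime; coprime⇒^-bijective)

  D[p^l+1]-permutation⇔coprime : ∀ l → IsPermutation F (D F (p ℕ.^ l ℕ.+ 1) 2) ⇔
                                      (gcd ((p ℕ.^ l ℕ.∸ 1) ℕ./ 2) (suc (suc n)) ≡ 1)
  D[p^l+1]-permutation⇔coprime l = mk⇔
    (λ (D-injective , _) → ^-injective⇒coprime d (injective⇒injective two≉0 (^-congˡ d) 2D≈1+[1-4x]^d D-injective))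
    (λ gcd≡1 → bijective⇒bijective two≉0 (^-congˡ d) 2D≈1+[1-4x]^d (coprime⇒^-bijective d gcd≡1))
    where
    d : ℕ
    d = (p ℕ.^ l ℕ.∸ 1) ℕ./ 2
    two≉0 : ¬ two ≈ 0#
    two≉0 = odd-char⇒two≉0 p p-odd char-p
    2D≈1+[1-4x]^d : ∀ x → two * D F (p ℕ.^ l ℕ.+ 1) 2 x ≈ 1# + (1# - four * x) ^ d
    2D≈1+[1-4x]^d = two*D[p^l+1]≈1+[1-4x]^d l (odd⇒n≡[n∸1]/2+[1+[n∸1]/2] (p ℕ.^ l) (odd-^ p l p-odd)) two≉0

open import Data.Nat using (ℕ; suc; _∸_; _^_; _/_; _%_; _+_; _≤_)
open import Data.Nat.GCD using (gcd)
open import Data.Nat.Primality using (Prime)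
open import Data.Product using (Σ; _×_)
open import Function.Bundles using (_⇔_)
open import Relation.Binary.PropositionalEquality using (_≡_)
open Arithmetic using (odd-prime-power≥3)

theorem2p12 : {c ℓ : Level} (p q l : ℕ) → Prime p → p % 2 ≡ 1 →
    Σ ℕ (λ m → 1 ≤ m × q ≡ p ^ m) → (F : FiniteField c ℓ q) → HasChar F p →
    IsPermutation F (D F (p ^ l + 1) 2) ⇔ (gcd ((p ^ l ∸ 1) / 2) (q ∸ 1) ≡ 1)
theorem2p12 p q l p-prime p-odd (m , 1≤m , q≡p^m) F char-p
  with q | ≡.subst (3 ≤_) (≡.sym q≡p^m) (odd-prime-power≥3 p-prime p-odd 1≤m)
... | 1                 | ℕ.s≤s ()
... | 2                 | ℕ.s≤s (ℕ.s≤s ())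
... | suc (suc (suc _)) | _ = PermutationCriterion.D[p^l+1]-permutation⇔coprime F p-prime p-odd char-p l
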